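{- Let $W_n$ denote the total number of weak left to right maxima, summed over all Dyck paths of semi-length $n$, and let $\mathrm{WTot}=\sum_{n\ge1}W_n z^{2n}$. Then, with $u$ the power series in $z$ defined by $u=\frac{1-2z^2-\sqrt{1-4z^2}}{2z^2}$ (so that $z^2=\frac{u}{(1+u)^2}$), \[ \mathrm{WTot}=\sum_{r=1}^\infty \frac{(1-u^2)u^r}{1-u^{2+r}}. \]
   Context: A Dyck path of semi-length $n$ is a lattice path from $(0,0)$ to $(2n,0)$ with $n$ up steps $(1,1)$ and $n$ down steps $(1,-1)$ never going below the $x$-axis. A peak is an up step immediately followed by a down step, and its height is the height of its top point. A weak left to right maximum is a peak whose height is greater than or equal to the heights of all peaks to its left. -}

module Defs where

open import Data.Bool using (Bool; true; false; if_then_else_)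
open import Data.Nat as ℕ using (ℕ; zero; suc; _≤_)
open import Data.List using (List; []; _∷_; map; concatMap)
open import Data.Nat.ListAction using (sum)
open import Data.Integer as ℤ using (ℤ; +_; -_)
open import Data.Product using (∃)
open import Relation.Binary.PropositionalEquality using (_≡_)

-- Dyck paths, encoded as lists of steps: true = up (1,1), false = down (1,-1)

allPaths : ℕ → List (List Bool)
allPaths zero    = [] ∷ []
allPaths (suc k) = concatMap (λ p → (true ∷ p) ∷ (false ∷ p) ∷ []) (allPaths k)

dyckFrom : ℕ → List Bool → Bool
dyckFrom zero    []            = true
dyckFrom (suc h) []            = false
dyckFrom h       (true ∷ xs)   = dyckFrom (suc h) xs
dyckFrom zero    (false ∷ xs)  = false
dyckFrom (suc h) (false ∷ xs)  = dyckFrom h xs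

isDyck : List Bool → Bool
isDyck = dyckFrom 0

peakHeightsFrom : ℕ → List Bool → List ℕ
peakHeightsFrom h []                     = []
peakHeightsFrom h (true ∷ false ∷ xs)    = suc h ∷ peakHeightsFrom (suc h) (false ∷ xs)
peakHeightsFrom h (true ∷ xs)            = peakHeightsFrom (suc h) xs
peakHeightsFrom h (false ∷ xs)           = peakHeightsFrom (h ℕ.∸ 1) xs

-- number of entries that are ≥ all entries to their left;
-- m is the maximum of the entries seen so far (0 initially; peak heights are ≥ 1)
weakLRMaxFrom : ℕ → List ℕ → ℕ
weakLRMaxFrom m []       = 0
weakLRMaxFrom m (h ∷ hs) with m ℕ.≤ᵇ h
... | true  = suc (weakLRMaxFrom h hs)
... | false = weakLRMaxFrom m hs

weakLRMax : List Bool → ℕ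
weakLRMax p = weakLRMaxFrom 0 (peakHeightsFrom 0 p)

W : ℕ → ℕ
W n = sum (map (λ p → if isDyck p then weakLRMax p else 0) (allPaths (n ℕ.* 2)))

Series : Set
Series = ℕ → ℤ

infix 4 _≈_
_≈_ : Series → Series → Set
f ≈ g = ∀ n → f n ≡ g n

sumUpTo : ℕ → (ℕ → ℤ) → ℤ
sumUpTo zero    h = h 0
sumUpTo (suc n) h = sumUpTo n h ℤ.+ h (suc n)

const : ℤ → Series
const c zero    = c
const c (suc n) = + 0

𝟙 : Series
𝟙 = const (+ 1)

Z : Series
Z 1 = + 1
Z _ = + 0

infixl 6 _⊕_ _⊖_
infixl 7 _⊛_
_⊕_ : Series → Series → Series
(f ⊕ g) n = f n ℤ.+ g n

_⊖_ : Series → Series → Series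
(f ⊖ g) n = f n ℤ.- g n

_⊛_ : Series → Series → Series
(f ⊛ g) n = sumUpTo n (λ k → f k ℤ.* g (n ℕ.∸ k))

infixr 8 _^ₛ_
_^ₛ_ : Series → ℕ → Series
f ^ₛ zero  = 𝟙
f ^ₛ suc k = f ⊛ (f ^ₛ k)

partialSum : (ℕ → Series) → ℕ → Series
partialSum t zero    n = + 0
partialSum t (suc N) n = partialSum t N n ℤ.+ t N n

-- S = Σ_{r≥0} t r in the formal (z-adic) topology: every coefficient of the
-- partial sums is eventually constant, equal to the corresponding coefficient of S
SumsTo : (ℕ → Series) → Series → Set
SumsTo t S = ∀ n → ∃ λ R → ∀ N → R ≤ N → partialSum t N n ≡ S n

WTot : Series
WTot zero          = + 0
WTot (suc zero)    = + 0
WTot (suc (suc m)) = evenCoef m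
  where
  evenCoef : ℕ → ℤ
  evenCoef m with m ℕ.% 2
  ... | zero  = + W (suc (m ℕ./ 2))
  ... | suc _ = + 0

-- Split the weak left-to-right maxima of a Dyck path by their height r ≥ 1. Whether a peak at
-- height r is a weak maximum depends only on whether an earlier peak exceeded r, so read a path
-- step by step and let b_h be the generating function of the weak maxima at height r of Dyck paths
-- from height h entered by an up step. Then b_h = z (b_(h+1) + b_(h−1)) for h < r, with b_(−1) = 0,
-- and b_r = z (d_(r−1) + b_(r−1)), where d_h = z^h C^(h+1) counts Dyck paths from height h and
-- C = 1 + u is the Catalan series, u = z² C². This linear system has a unique solution, and
-- z^(2r−h) C^(2r−h+1) (1 − u^(h+1)) solves it after multiplication by 1 − u^(r+2); at h = 0
-- this gives b_0 (1 − u^(r+2)) = (1 − u²) u^r.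

module Submission where

open import Defs
open import Data.Nat using (ℕ; suc; _+_)
open import Data.Integer using (+_)
open import Relation.Binary.PropositionalEquality using (_≡_)

open import Level using (0ℓ)
open import Function using (_∘_)
open import Data.Bool using (Bool; true; false; if_then_else_; T)
open import Data.Product using (_×_; _,_)
open import Data.Sum using (inj₁; inj₂)
open import Data.Maybe using (Maybe; just; nothing)
open import Data.Empty using (⊥-elim)
open import Data.List using (List; []; _∷_; length; map; concatMap)
open import Data.List.Relation.Unary.All as All using (All; []; _∷_)
open import Data.Nat.ListAction using (sum)
open import Data.Nat as ℕ using (zero; _≤_; _<_; z≤n; s≤s; _∸_; _*_; _≤ᵇ_; _%_; _/_)
import Data.Nat.Properties as ℕ
open import Data.Nat.DivMod using (m≡m%n+[m/n]*n)
open import Data.Integer as ℤ using (ℤ; -_)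
import Data.Integer.Properties as ℤ
open import Data.Integer.Tactic.RingSolver using (solve-∀)
open import Relation.Nullary using (yes; no)
open import Relation.Binary.PropositionalEquality
  using (refl; sym; trans; cong; cong₂; subst; _≢_; module ≡-Reasoning)
open import Algebra.Bundles using (CommutativeRing)
import Algebra.Properties.CommutativeSemigroup as CommutativeSemigroupProperties
import Algebra.Solver.Ring.AlmostCommutativeRing as ACR
import Relation.Binary.Reasoning.Setoid as SetoidReasoning

private
  module ℕ+ = CommutativeSemigroupProperties ℕ.+-commutativeSemigroup
  module ℤ+ = CommutativeSemigroupProperties ℤ.+-commutativeSemigroup

-- Formal power series over ℤ

sumUpTo-cong : ∀ n {f g : ℕ → ℤ} → (∀ k → k ≤ n → f k ≡ g k) → sumUpTo n f ≡ sumUpTo n g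
sumUpTo-cong zero    f≡g = f≡g 0 z≤n
sumUpTo-cong (suc n) f≡g =
  cong₂ ℤ._+_ (sumUpTo-cong n (λ k k≤n → f≡g k (ℕ.m≤n⇒m≤1+n k≤n))) (f≡g (suc n) ℕ.≤-refl)

sumUpTo-+ : ∀ n (f g : ℕ → ℤ) → sumUpTo n (λ k → f k ℤ.+ g k) ≡ sumUpTo n f ℤ.+ sumUpTo n g
sumUpTo-+ zero    f g = refl
sumUpTo-+ (suc n) f g = trans (cong (ℤ._+ (f (suc n) ℤ.+ g (suc n))) (sumUpTo-+ n f g))
  (ℤ+.interchange (sumUpTo n f) (sumUpTo n g) (f (suc n)) (g (suc n)))

sumUpTo-*ˡ : ∀ n c (f : ℕ → ℤ) → sumUpTo n (λ k → c ℤ.* f k) ≡ c ℤ.* sumUpTo n f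
sumUpTo-*ˡ zero    c f = refl
sumUpTo-*ˡ (suc n) c f = trans (cong (ℤ._+ (c ℤ.* f (suc n))) (sumUpTo-*ˡ n c f))
  (sym (ℤ.*-distribˡ-+ c (sumUpTo n f) (f (suc n))))

sumUpTo-zero : ∀ n (f : ℕ → ℤ) → (∀ k → k ≤ n → f k ≡ + 0) → sumUpTo n f ≡ + 0
sumUpTo-zero zero    f f≡0 = f≡0 0 z≤n
sumUpTo-zero (suc n) f f≡0 = cong₂ ℤ._+_
  (sumUpTo-zero n f (λ k k≤n → f≡0 k (ℕ.m≤n⇒m≤1+n k≤n))) (f≡0 (suc n) ℕ.≤-refl)

sumUpTo-suc : ∀ n (f : ℕ → ℤ) → sumUpTo (suc n) f ≡ f 0 ℤ.+ sumUpTo n (f ∘ suc)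
sumUpTo-suc zero    f = refl
sumUpTo-suc (suc n) f = trans (cong (ℤ._+ f (suc (suc n))) (sumUpTo-suc n f))
  (ℤ.+-assoc (f 0) (sumUpTo n (f ∘ suc)) (f (suc (suc n))))

𝟘 : Series
𝟘 _ = + 0

-ₛ_ : Series → Series
(-ₛ f) n = - f n

tail : Series → Series
tail f = f ∘ suc

infixr 7 _∙_
_∙_ : ℤ → Series → Series
(c ∙ f) n = c ℤ.* f n

≈-refl : ∀ {f} → f ≈ f
≈-refl _ = refl

≈-sym : ∀ {f g} → f ≈ g → g ≈ f
≈-sym f≈g n = sym (f≈g n)

≈-trans : ∀ {f g h} → f ≈ g → g ≈ h → f ≈ h
≈-trans f≈g g≈h n = trans (f≈g n) (g≈h n)

≡⇒≈ : ∀ {f g} → f ≡ g → f ≈ g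
≡⇒≈ refl = ≈-refl

⊕-identityˡ : ∀ f → 𝟘 ⊕ f ≈ f
⊕-identityˡ f n = ℤ.+-identityˡ (f n)

⊕-identityʳ : ∀ f → f ⊕ 𝟘 ≈ f
⊕-identityʳ f n = ℤ.+-identityʳ (f n)

⊕-cong : ∀ {f f′ g g′} → f ≈ f′ → g ≈ g′ → f ⊕ g ≈ f′ ⊕ g′
⊕-cong f≈f′ g≈g′ n = cong₂ ℤ._+_ (f≈f′ n) (g≈g′ n)

⊛-cong : ∀ {f f′ g g′} → f ≈ f′ → g ≈ g′ → f ⊛ g ≈ f′ ⊛ g′
⊛-cong f≈f′ g≈g′ n = sumUpTo-cong n (λ k _ → cong₂ ℤ._*_ (f≈f′ k) (g≈g′ (n ∸ k)))

⊛-sucˡ : ∀ f g n → (f ⊛ g) (suc n) ≡ f 0 ℤ.* g (suc n) ℤ.+ (tail f ⊛ g) n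
⊛-sucˡ f g n = sumUpTo-suc n (λ k → f k ℤ.* g (suc n ∸ k))

⊛-sucʳ : ∀ f g n → (f ⊛ g) (suc n) ≡ (f ⊛ tail g) n ℤ.+ f (suc n) ℤ.* g 0
⊛-sucʳ f g n = cong₂ ℤ._+_
  (sumUpTo-cong n (λ k k≤n → cong (λ i → f k ℤ.* g i) (ℕ.+-∸-assoc 1 k≤n)))
  (cong (λ i → f (suc n) ℤ.* g i) (ℕ.n∸n≡0 n))

⊛-zeroˡ : ∀ f → 𝟘 ⊛ f ≈ 𝟘
⊛-zeroˡ f n = sumUpTo-zero n _ (λ k _ → ℤ.*-zeroˡ (f (n ∸ k)))

⊛-distribʳ : ∀ f g h → (f ⊕ g) ⊛ h ≈ f ⊛ h ⊕ g ⊛ h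
⊛-distribʳ f g h n =
  trans (sumUpTo-cong n (λ k _ → ℤ.*-distribʳ-+ (h (n ∸ k)) (f k) (g k))) (sumUpTo-+ n _ _)

⊛-∙ : ∀ c f g → (c ∙ f) ⊛ g ≈ c ∙ (f ⊛ g)
⊛-∙ c f g n =
  trans (sumUpTo-cong n (λ k _ → ℤ.*-assoc c (f k) (g (n ∸ k)))) (sumUpTo-*ˡ n c _)

⊛-comm : ∀ f g → f ⊛ g ≈ g ⊛ f
⊛-comm f g zero    = ℤ.*-comm (f 0) (g 0)
⊛-comm f g (suc n) = begin
  (f ⊛ g) (suc n)                      ≡⟨ ⊛-sucˡ f g n ⟩
  f 0 ℤ.* g (suc n) ℤ.+ (tail f ⊛ g) n ≡⟨ cong₂ ℤ._+_ (ℤ.*-comm (f 0) (g (suc n))) (⊛-comm (tail f) g n) ⟩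
  g (suc n) ℤ.* f 0 ℤ.+ (g ⊛ tail f) n ≡⟨ ℤ.+-comm (g (suc n) ℤ.* f 0) _ ⟩
  (g ⊛ tail f) n ℤ.+ g (suc n) ℤ.* f 0 ≡⟨ sym (⊛-sucʳ g f n) ⟩
  (g ⊛ f) (suc n)                      ∎
  where open ≡-Reasoning

⊛-assoc : ∀ f g h → (f ⊛ g) ⊛ h ≈ f ⊛ (g ⊛ h)
⊛-assoc f g h zero    = ℤ.*-assoc (f 0) (g 0) (h 0)
⊛-assoc f g h (suc n) = begin
  ((f ⊛ g) ⊛ h) (suc n)
    ≡⟨ ⊛-sucˡ (f ⊛ g) h n ⟩
  lead ℤ.+ (tail (f ⊛ g) ⊛ h) n
    ≡⟨ cong (ℤ._+_ lead) (⊛-cong {g = h} (⊛-sucˡ f g) ≈-refl n) ⟩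
  lead ℤ.+ ((f 0 ∙ tail g ⊕ tail f ⊛ g) ⊛ h) n
    ≡⟨ cong (ℤ._+_ lead) (⊛-distribʳ (f 0 ∙ tail g) (tail f ⊛ g) h n) ⟩
  lead ℤ.+ (((f 0 ∙ tail g) ⊛ h) n ℤ.+ ((tail f ⊛ g) ⊛ h) n)
    ≡⟨ cong₂ (λ a b → lead ℤ.+ (a ℤ.+ b)) (⊛-∙ (f 0) (tail g) h n) (⊛-assoc (tail f) g h n) ⟩
  lead ℤ.+ (f 0 ℤ.* (tail g ⊛ h) n ℤ.+ (tail f ⊛ (g ⊛ h)) n)
    ≡⟨ factor (f 0) (g 0) (h (suc n)) ((tail g ⊛ h) n) ((tail f ⊛ (g ⊛ h)) n) ⟩
  f 0 ℤ.* (g 0 ℤ.* h (suc n) ℤ.+ (tail g ⊛ h) n) ℤ.+ (tail f ⊛ (g ⊛ h)) n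
    ≡⟨ cong (λ x → f 0 ℤ.* x ℤ.+ (tail f ⊛ (g ⊛ h)) n) (sym (⊛-sucˡ g h n)) ⟩
  f 0 ℤ.* (g ⊛ h) (suc n) ℤ.+ (tail f ⊛ (g ⊛ h)) n
    ≡⟨ sym (⊛-sucˡ f (g ⊛ h) n) ⟩
  (f ⊛ (g ⊛ h)) (suc n) ∎
  where
  open ≡-Reasoning
  lead = f 0 ℤ.* g 0 ℤ.* h (suc n)
  factor : ∀ a b c d e → a ℤ.* b ℤ.* c ℤ.+ (a ℤ.* d ℤ.+ e) ≡ a ℤ.* (b ℤ.* c ℤ.+ d) ℤ.+ e
  factor = solve-∀

⊛-identityˡ : ∀ f → 𝟙 ⊛ f ≈ f
⊛-identityˡ f zero    = ℤ.*-identityˡ (f 0)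
⊛-identityˡ f (suc n) = trans (⊛-sucˡ 𝟙 f n)
  (trans (cong₂ ℤ._+_ (ℤ.*-identityˡ (f (suc n))) (⊛-zeroˡ f n)) (ℤ.+-identityʳ _))

seriesRing : CommutativeRing 0ℓ 0ℓ
seriesRing = record
  { Carrier = Series
  ; _≈_ = _≈_
  ; _+_ = _⊕_
  ; _*_ = _⊛_
  ; -_ = -ₛ_
  ; 0# = 𝟘
  ; 1# = 𝟙
  ; isCommutativeRing = record
    { isRing = record
      { +-isAbelianGroup = record
        { isGroup = record
          { isMonoid = record
            { isSemigroup = record
              { isMagma = record
                { isEquivalence = record { refl = ≈-refl ; sym = ≈-sym ; trans = ≈-trans }
                ; ∙-cong = ⊕-cong }
              ; assoc = λ f g h n → ℤ.+-assoc (f n) (g n) (h n) }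
            ; identity = (λ f n → ℤ.+-identityˡ (f n)) , (λ f n → ℤ.+-identityʳ (f n)) }
          ; inverse = (λ f n → ℤ.+-inverseˡ (f n)) , (λ f n → ℤ.+-inverseʳ (f n))
          ; ⁻¹-cong = λ f≈g n → cong -_ (f≈g n) }
        ; comm = λ f g n → ℤ.+-comm (f n) (g n) }
      ; *-cong = ⊛-cong
      ; *-assoc = ⊛-assoc
      ; *-identity = ⊛-identityˡ , λ f → ≈-trans (⊛-comm f 𝟙) (⊛-identityˡ f)
      ; distrib = (λ h f g → ≈-trans (⊛-comm h (f ⊕ g)) (≈-trans (⊛-distribʳ f g h)
                               (⊕-cong (⊛-comm f h) (⊛-comm g h))))
                , (λ h f g → ⊛-distribʳ f g h) }
    ; *-comm = ⊛-comm } }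

const-* : ∀ a b → const (a ℤ.* b) ≈ const a ⊛ const b
const-* a b zero    = refl
const-* a b (suc n) = sym (trans (⊛-sucˡ (const a) (const b) n)
  (cong₂ ℤ._+_ (ℤ.*-zeroʳ a) (⊛-zeroˡ (const b) n)))

const-homomorphism : CommutativeRing.rawRing ℤ.+-*-commutativeRing
  ACR.-Raw-AlmostCommutative⟶ ACR.fromCommutativeRing seriesRing
const-homomorphism = record
  { ⟦_⟧ = const
  ; +-homo = λ { a b zero → refl ; a b (suc n) → refl }
  ; *-homo = const-*
  ; -‿homo = λ { a zero → refl ; a (suc n) → refl }
  ; 0-homo = λ { zero → refl ; (suc n) → refl }
  ; 1-homo = ≈-refl }

const-≟ : ∀ a b → Maybe (const a ≈ const b)
const-≟ a b with a ℤ.≟ b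
... | yes refl = just ≈-refl
... | no _     = nothing

open import Algebra.Solver.Ring (CommutativeRing.rawRing ℤ.+-*-commutativeRing)
  (ACR.fromCommutativeRing seriesRing) const-homomorphism const-≟
  using (Polynomial; solve; _:+_; _:-_; _:*_; _:=_; con)
module ≈-Reasoning = SetoidReasoning (CommutativeRing.setoid seriesRing)

1ₚ : ∀ {n} → Polynomial n
1ₚ = con (+ 1)

Z⊛-zero : ∀ f → (Z ⊛ f) 0 ≡ + 0
Z⊛-zero f = ℤ.*-zeroˡ (f 0)

Z⊛-suc : ∀ f n → (Z ⊛ f) (suc n) ≡ f n
Z⊛-suc f n = begin
  (Z ⊛ f) (suc n)                     ≡⟨ ⊛-sucˡ Z f n ⟩
  + 0 ℤ.* f (suc n) ℤ.+ (tail Z ⊛ f) n ≡⟨ cong₂ ℤ._+_ (ℤ.*-zeroˡ (f (suc n))) (⊛-cong tail-Z (≈-refl {f}) n) ⟩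
  + 0 ℤ.+ (𝟙 ⊛ f) n                   ≡⟨ ℤ.+-identityˡ _ ⟩
  (𝟙 ⊛ f) n                           ≡⟨ ⊛-identityˡ f n ⟩
  f n                                 ∎
  where
  open ≡-Reasoning
  tail-Z : tail Z ≈ 𝟙
  tail-Z zero    = refl
  tail-Z (suc n) = refl

≈Z⊛-shift : ∀ {f g} → f 0 ≡ + 0 → (∀ n → f (suc n) ≡ g n) → f ≈ Z ⊛ g
≈Z⊛-shift {g = g} f₀≡0 f≡g zero    = trans f₀≡0 (sym (Z⊛-zero g))
≈Z⊛-shift {g = g} f₀≡0 f≡g (suc n) = trans (f≡g n) (sym (Z⊛-suc g n))

Z⊛⊕-congʳ : ∀ f {g g′} → g ≈ g′ → Z ⊛ (f ⊕ g) ≈ Z ⊛ (f ⊕ g′)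
Z⊛⊕-congʳ f g≈g′ = ⊛-cong (≈-refl {Z}) (⊕-cong (≈-refl {f}) g≈g′)

Z⊛-cancel : ∀ {f g} → Z ⊛ f ≈ Z ⊛ g → f ≈ g
Z⊛-cancel {f} {g} Zf≈Zg n = trans (sym (Z⊛-suc f n)) (trans (Zf≈Zg (suc n)) (Z⊛-suc g n))

const⊛ : ∀ a f n → (const a ⊛ f) n ≡ a ℤ.* f n
const⊛ a f zero    = refl
const⊛ a f (suc n) = trans (⊛-sucˡ (const a) f n)
  (trans (cong (ℤ._+_ (a ℤ.* f (suc n))) (⊛-zeroˡ f n)) (ℤ.+-identityʳ _))

const⊛-cancel : ∀ a {f} → .{{ℤ.NonZero a}} → const a ⊛ f ≈ 𝟘 → f ≈ 𝟘
const⊛-cancel a {f} af≈0 n =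
  ℤ.*-cancelˡ-≡ a (f n) (+ 0) (trans (sym (const⊛ a f n)) (trans (af≈0 n) (sym (ℤ.*-zeroʳ a))))

⊛-cancel-unit : ∀ {f g c} → c 0 ≡ + 1 → f ⊛ c ≈ g ⊛ c → f ≈ g
⊛-cancel-unit {f} {g} {c} c₀≡1 fc≈gc n =
  ℤ.i-j≡0⇒i≡j (f n) (g n) (vanishes-upTo n n ℕ.≤-refl)
  where
  d = f ⊖ g
  dc≈0 : d ⊛ c ≈ 𝟘
  dc≈0 = begin
    d ⊛ c         ≈⟨ solve 3 (λ f g c → (f :- g) :* c := f :* c :- g :* c) ≈-refl f g c ⟩
    f ⊛ c ⊖ g ⊛ c ≈⟨ (λ m → cong (ℤ._- (g ⊛ c) m) (fc≈gc m)) ⟩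
    g ⊛ c ⊖ g ⊛ c ≈⟨ (λ m → ℤ.+-inverseʳ ((g ⊛ c) m)) ⟩
    𝟘             ∎
    where open ≈-Reasoning
  -- (d ⊛ c) (n + 1) is d (n + 1) · c 0 plus terms involving only d 0, …, d n
  vanishes-upTo : ∀ n k → k ≤ n → d k ≡ + 0
  vanishes-upTo zero    .zero z≤n = trans (sym (ℤ.*-identityʳ (d 0)))
    (trans (cong (d 0 ℤ.*_) (sym c₀≡1)) (dc≈0 0))
  vanishes-upTo (suc n) k k≤1+n with ℕ.m≤n⇒m<n∨m≡n k≤1+n
  ... | inj₁ (s≤s k≤n) = vanishes-upTo n k k≤n
  ... | inj₂ refl = begin
    d (suc n)                                  ≡⟨ sym (ℤ.*-identityʳ (d (suc n))) ⟩
    d (suc n) ℤ.* + 1                          ≡⟨ cong (d (suc n) ℤ.*_) (sym c₀≡1) ⟩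
    d (suc n) ℤ.* c 0                          ≡⟨ sym (ℤ.+-identityˡ _) ⟩
    + 0 ℤ.+ d (suc n) ℤ.* c 0                  ≡⟨ cong (ℤ._+ d (suc n) ℤ.* c 0) (sym lower≡0) ⟩
    (d ⊛ tail c) n ℤ.+ d (suc n) ℤ.* c 0       ≡⟨ sym (⊛-sucʳ d c n) ⟩
    (d ⊛ c) (suc n)                            ≡⟨ dc≈0 (suc n) ⟩
    + 0                                        ∎
    where
    open ≡-Reasoning
    lower≡0 : (d ⊛ tail c) n ≡ + 0
    lower≡0 = sumUpTo-zero n _ (λ j j≤n →
      trans (cong (ℤ._* c (suc (n ∸ j))) (vanishes-upTo n j j≤n)) (ℤ.*-zeroˡ (c (suc (n ∸ j)))))

-- Linear systems of walks on a segment and on a half-line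

below : (ℕ → Series) → ℕ → Series
below X zero    = 𝟘
below X (suc h) = X h

record SegmentSystem (r : ℕ) (g : Series) (X : ℕ → Series) : Set where
  field
    inner : ∀ h → h < r → X h ≈ Z ⊛ (X (suc h) ⊕ below X h)
    top   : X r ≈ Z ⊛ (g ⊕ below X r)

module _ {r g X} (S : SegmentSystem r g X) where
  open SegmentSystem S

  SegmentSystem-constant : ∀ h → h ≤ r → X h 0 ≡ + 0
  SegmentSystem-constant h h≤r with ℕ.m≤n⇒m<n∨m≡n h≤r
  ... | inj₁ h<r  = trans (inner h h<r 0) (Z⊛-zero (X (suc h) ⊕ below X h))
  ... | inj₂ refl = trans (top 0) (Z⊛-zero (g ⊕ below X r))

  SegmentSystem-⊛ : ∀ c → SegmentSystem r (g ⊛ c) (λ h → X h ⊛ c)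
  SegmentSystem-⊛ c = record
    { inner = λ h h<r →
        ≈-trans (⊛-cong (inner h h<r) (≈-refl {c})) (distribute {X (suc h)} {below X h} (below-⊛ h))
    ; top   = ≈-trans (⊛-cong top (≈-refl {c})) (distribute {g} {below X r} (below-⊛ r)) }
    where
    below-⊛ : ∀ h → below X h ⊛ c ≈ below (λ h → X h ⊛ c) h
    below-⊛ zero    = ⊛-zeroˡ c
    below-⊛ (suc h) = ≈-refl
    distribute : ∀ {a b b′} → b ⊛ c ≈ b′ → Z ⊛ (a ⊕ b) ⊛ c ≈ Z ⊛ (a ⊛ c ⊕ b′)
    distribute {a} {b} bc≈b′ = ≈-trans
      (solve 4 (λ z a b c → z :* (a :+ b) :* c := z :* (a :* c :+ b :* c)) ≈-refl Z a b c)
      (Z⊛⊕-congʳ (a ⊛ c) bc≈b′)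

SegmentSystem-unique : ∀ {r g g′ X Y} → SegmentSystem r g X → SegmentSystem r g′ Y → g ≈ g′ →
                       ∀ h → h ≤ r → X h ≈ Y h
SegmentSystem-unique {r} {g} {g′} {X} {Y} SX SY g≈g′ h h≤r n = agree n h h≤r
  where
  module SX = SegmentSystem SX
  module SY = SegmentSystem SY
  agree : ∀ n h → h ≤ r → X h n ≡ Y h n
  below-agree : ∀ n h → h ≤ r → below X h n ≡ below Y h n
  step : ∀ n h {a a′} → h ≤ r → X h ≈ Z ⊛ (a ⊕ below X h) → Y h ≈ Z ⊛ (a′ ⊕ below Y h) →
         a n ≡ a′ n → X h (suc n) ≡ Y h (suc n)

  agree zero h h≤r = trans (SegmentSystem-constant SX h h≤r) (sym (SegmentSystem-constant SY h h≤r))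
  agree (suc n) h h≤r with ℕ.m≤n⇒m<n∨m≡n h≤r
  ... | inj₁ h<r  = step n h {X (suc h)} {Y (suc h)} h≤r (SX.inner h h<r) (SY.inner h h<r) (agree n (suc h) h<r)
  ... | inj₂ refl = step n r {g} {g′} h≤r SX.top SY.top (g≈g′ n)

  below-agree n zero    _     = refl
  below-agree n (suc h) h<r   = agree n h (ℕ.<⇒≤ h<r)

  step n h {a} {a′} h≤r Xh≈ Yh≈ a≡a′ = begin
    X h (suc n)          ≡⟨ trans (Xh≈ (suc n)) (Z⊛-suc (a ⊕ below X h) n) ⟩
    a n ℤ.+ below X h n  ≡⟨ cong₂ ℤ._+_ a≡a′ (below-agree n h h≤r) ⟩
    a′ n ℤ.+ below Y h n ≡⟨ sym (trans (Yh≈ (suc n)) (Z⊛-suc (a′ ⊕ below Y h) n)) ⟩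
    Y h (suc n)          ∎
    where open ≡-Reasoning

record DyckSystem (X : ℕ → Series) : Set where
  field
    ground : X 0 ≈ 𝟙 ⊕ Z ⊛ X 1
    lifted : ∀ h → X (suc h) ≈ Z ⊛ (X (suc (suc h)) ⊕ X h)

DyckSystem-unique : ∀ {X Y} → DyckSystem X → DyckSystem Y → ∀ h → X h ≈ Y h
DyckSystem-unique {X} {Y} SX SY h n = agree n h
  where
  module SX = DyckSystem SX
  module SY = DyckSystem SY
  agree : ∀ n h → X h n ≡ Y h n
  agree zero zero = trans (SX.ground 0)
    (trans (cong (ℤ._+_ (+ 1)) (trans (Z⊛-zero (X 1)) (sym (Z⊛-zero (Y 1))))) (sym (SY.ground 0)))
  agree zero (suc h) = trans (SX.lifted h 0)
    (trans (Z⊛-zero (X (suc (suc h)) ⊕ X h)) (sym (trans (SY.lifted h 0) (Z⊛-zero (Y (suc (suc h)) ⊕ Y h)))))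
  agree (suc n) zero = trans (SX.ground (suc n))
    (trans (cong (ℤ._+_ (+ 0)) (trans (Z⊛-suc (X 1) n) (trans (agree n 1) (sym (Z⊛-suc (Y 1) n)))))
      (sym (SY.ground (suc n))))
  agree (suc n) (suc h) = trans (SX.lifted h (suc n))
    (trans (Z⊛-suc (X (suc (suc h)) ⊕ X h) n)
      (trans (cong₂ ℤ._+_ (agree n (suc (suc h))) (agree n h))
        (sym (trans (SY.lifted h (suc n)) (Z⊛-suc (Y (suc (suc h)) ⊕ Y h) n)))))

-- Weak left-to-right maxima by height

sumPaths : ℕ → (List Bool → ℕ) → ℕ
sumPaths k f = sum (map f (allPaths k))

sumPaths-suc : ∀ k f → sumPaths (suc k) f ≡ sumPaths k (f ∘ (true ∷_)) + sumPaths k (f ∘ (false ∷_))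
sumPaths-suc k f = go (allPaths k)
  where
  go : ∀ ps → sum (map f (concatMap (λ p → (true ∷ p) ∷ (false ∷ p) ∷ []) ps))
            ≡ sum (map (f ∘ (true ∷_)) ps) + sum (map (f ∘ (false ∷_)) ps)
  go []       = refl
  go (p ∷ ps) = trans (cong (λ s → f (true ∷ p) + (f (false ∷ p) + s)) (go ps))
    (trans (sym (ℕ.+-assoc (f (true ∷ p)) (f (false ∷ p)) _))
           (ℕ+.interchange (f (true ∷ p)) (f (false ∷ p)) _ _))

sumPaths-cong : ∀ k {f g} → (∀ p → length p ≡ k → f p ≡ g p) → sumPaths k f ≡ sumPaths k g
sumPaths-cong zero    f≡g = cong (_+ 0) (f≡g [] refl)
sumPaths-cong (suc k) {f} {g} f≡g = begin
  sumPaths (suc k) f                                          ≡⟨ sumPaths-suc k f ⟩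
  sumPaths k (f ∘ (true ∷_)) + sumPaths k (f ∘ (false ∷_))
    ≡⟨ cong₂ _+_ (sumPaths-cong k (λ p l → f≡g (true ∷ p) (cong suc l)))
                 (sumPaths-cong k (λ p l → f≡g (false ∷ p) (cong suc l))) ⟩
  sumPaths k (g ∘ (true ∷_)) + sumPaths k (g ∘ (false ∷_))    ≡⟨ sym (sumPaths-suc k g) ⟩
  sumPaths (suc k) g                                          ∎
  where open ≡-Reasoning

sumPaths-zero : ∀ k {f} → (∀ p → length p ≡ k → f p ≡ 0) → sumPaths k f ≡ 0
sumPaths-zero k f≡0 = trans (sumPaths-cong k f≡0) (zeros (allPaths k))
  where
  zeros : ∀ ps → sum (map (λ _ → 0) ps) ≡ 0
  zeros []       = refl
  zeros (_ ∷ ps) = zeros ps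

sumPaths-+ : ∀ k f g → sumPaths k (λ p → f p + g p) ≡ sumPaths k f + sumPaths k g
sumPaths-+ k f g = go (allPaths k)
  where
  go : ∀ ps → sum (map (λ p → f p + g p) ps) ≡ sum (map f ps) + sum (map g ps)
  go []       = refl
  go (p ∷ ps) = trans (cong (_+_ (f p + g p)) (go ps))
    (ℕ+.interchange (f p) (g p) (sum (map f ps)) (sum (map g ps)))

sumTo : ℕ → (ℕ → ℕ) → ℕ
sumTo zero    g = 0
sumTo (suc N) g = sumTo N g + g (suc N)

sumTo-zero : ∀ N {g} → (∀ r → r ≤ N → g r ≡ 0) → sumTo N g ≡ 0
sumTo-zero zero    g≡0 = refl
sumTo-zero (suc N) g≡0 = cong₂ _+_ (sumTo-zero N (λ r r≤N → g≡0 r (ℕ.m≤n⇒m≤1+n r≤N))) (g≡0 (suc N) ℕ.≤-refl)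

sumTo-+ : ∀ N f g → sumTo N (λ r → f r + g r) ≡ sumTo N f + sumTo N g
sumTo-+ zero    f g = refl
sumTo-+ (suc N) f g = trans (cong (_+ (f (suc N) + g (suc N))) (sumTo-+ N f g))
  (ℕ+.interchange (sumTo N f) (sumTo N g) (f (suc N)) (g (suc N)))

sumTo-sumPaths : ∀ N k (f : ℕ → List Bool → ℕ) →
                 sumTo N (λ r → sumPaths k (f r)) ≡ sumPaths k (λ p → sumTo N (λ r → f r p))
sumTo-sumPaths zero    k f = sym (sumPaths-zero k (λ _ _ → refl))
sumTo-sumPaths (suc N) k f =
  trans (cong (_+ sumPaths k (f (suc N))) (sumTo-sumPaths N k f)) (sym (sumPaths-+ k _ _))

δ : ℕ → ℕ → ℕ
δ zero    zero    = 1
δ zero    (suc r) = 0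
δ (suc x) zero    = 0
δ (suc x) (suc r) = δ x r

δ-refl : ∀ x → δ x x ≡ 1
δ-refl zero    = refl
δ-refl (suc x) = δ-refl x

δ-≢ : ∀ {x r} → x ≢ r → δ x r ≡ 0
δ-≢ {zero}  {zero}  x≢r = ⊥-elim (x≢r refl)
δ-≢ {zero}  {suc r} x≢r = refl
δ-≢ {suc x} {zero}  x≢r = refl
δ-≢ {suc x} {suc r} x≢r = δ-≢ (x≢r ∘ cong suc)

sumTo-δ : ∀ N x → 1 ≤ x → x ≤ N → sumTo N (δ x) ≡ 1
sumTo-δ zero    x 1≤x x≤0 = ⊥-elim (ℕ.<-irrefl refl (ℕ.<-≤-trans 1≤x x≤0))
sumTo-δ (suc N) x 1≤x x≤1+N with ℕ.m≤n⇒m<n∨m≡n x≤1+N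
... | inj₁ (s≤s x≤N) = cong₂ _+_ (sumTo-δ N x 1≤x x≤N) (δ-≢ (λ x≡1+N → ℕ.<-irrefl x≡1+N (s≤s x≤N)))
... | inj₂ refl      = cong₂ _+_ (sumTo-zero N (λ r r≤N → δ-≢ (λ 1+N≡r → ℕ.<-irrefl (sym 1+N≡r) (s≤s r≤N))))
                                 (δ-refl (suc N))

weakLRMaxAt : ℕ → ℕ → List ℕ → ℕ
weakLRMaxAt r m []       = 0
weakLRMaxAt r m (x ∷ xs) with m ≤ᵇ x
... | true  = δ x r + weakLRMaxAt r x xs
... | false = weakLRMaxAt r m xs

weakLRMaxAt-above : ∀ r m xs → r < m → weakLRMaxAt r m xs ≡ 0
weakLRMaxAt-above r m []       r<m = refl
weakLRMaxAt-above r m (x ∷ xs) r<m with m ≤ᵇ x in m≤ᵇx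
... | true  = cong₂ _+_ (δ-≢ (λ x≡r → ℕ.<-irrefl (sym x≡r) r<x)) (weakLRMaxAt-above r x xs r<x)
  where r<x = ℕ.<-≤-trans r<m (ℕ.≤ᵇ⇒≤ m x (subst T (sym m≤ᵇx) _))
... | false = weakLRMaxAt-above r m xs r<m

weakLRMaxAt-below : ∀ r m xs → m ≤ r → weakLRMaxAt r m xs ≡ weakLRMaxAt r 0 xs
weakLRMaxAt-below r m []       m≤r = refl
weakLRMaxAt-below r m (x ∷ xs) m≤r with m ≤ᵇ x in m≤ᵇx
... | true  = refl
... | false = begin
  weakLRMaxAt r m xs          ≡⟨ weakLRMaxAt-below r m xs m≤r ⟩
  weakLRMaxAt r 0 xs          ≡⟨ sym (weakLRMaxAt-below r x xs x≤r) ⟩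
  weakLRMaxAt r x xs          ≡⟨ cong (_+ weakLRMaxAt r x xs) (sym (δ-≢ (λ x≡r → ℕ.<-irrefl x≡r x<r))) ⟩
  δ x r + weakLRMaxAt r x xs  ∎
  where
  open ≡-Reasoning
  x<m : x < m
  x<m = ℕ.≰⇒> (λ m≤x → subst T m≤ᵇx (ℕ.≤⇒≤ᵇ m≤x))
  x<r = ℕ.<-≤-trans x<m m≤r
  x≤r = ℕ.<⇒≤ x<r

InRange : ℕ → ℕ → Set
InRange N x = 1 ≤ x × x ≤ N

weakLRMaxFrom-decompose : ∀ N m xs → All (InRange N) xs →
                          weakLRMaxFrom m xs ≡ sumTo N (λ r → weakLRMaxAt r m xs)
weakLRMaxFrom-decompose N m []       _ = sym (sumTo-zero N (λ _ _ → refl))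
weakLRMaxFrom-decompose N m (x ∷ xs) ((1≤x , x≤N) ∷ xs∈N) with m ≤ᵇ x
... | true  = sym (begin
  sumTo N (λ r → δ x r + weakLRMaxAt r x xs)           ≡⟨ sumTo-+ N (δ x) (λ r → weakLRMaxAt r x xs) ⟩
  sumTo N (δ x) + sumTo N (λ r → weakLRMaxAt r x xs)   ≡⟨ cong₂ _+_ (sumTo-δ N x 1≤x x≤N)
                                                              (sym (weakLRMaxFrom-decompose N x xs xs∈N)) ⟩
  suc (weakLRMaxFrom x xs)                             ∎)
  where open ≡-Reasoning
... | false = weakLRMaxFrom-decompose N m xs xs∈N

-- peak heights of a walk starting at height h, from left to right; afterUp says whether
-- the previous step was an up step, so that a down step now completes a peak at height h
peaks : ℕ → Bool → List Bool → List ℕ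
peaks h afterUp (true ∷ p)  = peaks (suc h) true p
peaks h false   (false ∷ p) = peaks (h ∸ 1) false p
peaks h true    (false ∷ p) = h ∷ peaks (h ∸ 1) false p
peaks h afterUp []          = []

peakHeightsFrom≡peaks : ∀ h p → peakHeightsFrom h p ≡ peaks h false p
peakHeightsFrom-up≡peaks : ∀ h p → peakHeightsFrom h (true ∷ p) ≡ peaks (suc h) true p
peakHeightsFrom≡peaks h []          = refl
peakHeightsFrom≡peaks h (true ∷ p)  = peakHeightsFrom-up≡peaks h p
peakHeightsFrom≡peaks h (false ∷ p) = peakHeightsFrom≡peaks (h ∸ 1) p
peakHeightsFrom-up≡peaks h []          = refl
peakHeightsFrom-up≡peaks h (true ∷ p)  = peakHeightsFrom-up≡peaks (suc h) p
peakHeightsFrom-up≡peaks h (false ∷ p) = cong (suc h ∷_) (peakHeightsFrom≡peaks h p)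

InRange-mono : ∀ {N M x} → N ≤ M → InRange N x → InRange M x
InRange-mono N≤M (1≤x , x≤N) = 1≤x , ℕ.≤-trans x≤N N≤M

peaks-inRange : ∀ h afterUp p → (afterUp ≡ true → 1 ≤ h) → All (InRange (h + length p)) (peaks h afterUp p)
peaks-inRange-down : ∀ h p → All (InRange (h + suc (length p))) (peaks (h ∸ 1) false p)

peaks-inRange h afterUp (true ∷ p) _ =
  All.map (InRange-mono (ℕ.≤-reflexive (sym (ℕ.+-suc h (length p)))))
          (peaks-inRange (suc h) true p (λ _ → s≤s z≤n))
peaks-inRange h false (false ∷ p) _ = peaks-inRange-down h p
peaks-inRange h true (false ∷ p) 1≤h = (1≤h refl , ℕ.m≤m+n h (suc (length p))) ∷ peaks-inRange-down h p
peaks-inRange h afterUp [] _ = []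

peaks-inRange-down h p = All.map (InRange-mono (ℕ.+-mono-≤ (ℕ.m∸n≤m h 1) (ℕ.n≤1+n (length p))))
                                 (peaks-inRange (h ∸ 1) false p (λ ()))

weakLRMaxAt-afterUp : ∀ r h p → h < r → weakLRMaxAt r 0 (peaks h true p) ≡ weakLRMaxAt r 0 (peaks h false p)
weakLRMaxAt-afterUp r h []          h<r = refl
weakLRMaxAt-afterUp r h (true ∷ p)  h<r = refl
weakLRMaxAt-afterUp r h (false ∷ p) h<r =
  cong₂ _+_ (δ-≢ (λ h≡r → ℕ.<-irrefl h≡r h<r)) (weakLRMaxAt-below r h (peaks (h ∸ 1) false p) (ℕ.<⇒≤ h<r))

weakLRMaxAt-peaks-above : ∀ r h p → r < h → weakLRMaxAt r 0 (peaks h true p) ≡ 0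
weakLRMaxAt-peaks-above r h []          r<h = refl
weakLRMaxAt-peaks-above r h (true ∷ p)  r<h = weakLRMaxAt-peaks-above r (suc h) p (ℕ.m<n⇒m<1+n r<h)
weakLRMaxAt-peaks-above r h (false ∷ p) r<h =
  cong₂ _+_ (δ-≢ (λ h≡r → ℕ.<-irrefl (sym h≡r) r<h)) (weakLRMaxAt-above r h (peaks (h ∸ 1) false p) r<h)

countDyck : ℕ → List Bool → ℕ
countDyck h p = if dyckFrom h p then 1 else 0

-- the contribution of one path to the series b_h of the proof idea
countWeakMaxAt : ℕ → ℕ → List Bool → ℕ
countWeakMaxAt r h p = if dyckFrom h p then weakLRMaxAt r 0 (peaks h true p) else 0

countWeakMaxAt-up : ∀ r h p → countWeakMaxAt r h (true ∷ p) ≡ countWeakMaxAt r (suc h) p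
countWeakMaxAt-up r zero    p = refl
countWeakMaxAt-up r (suc h) p = refl

countWeakMaxAt-[] : ∀ r h → countWeakMaxAt r h [] ≡ 0
countWeakMaxAt-[] r zero    = refl
countWeakMaxAt-[] r (suc h) = refl

countWeakMaxAt-above : ∀ r h p → r < h → countWeakMaxAt r h p ≡ 0
countWeakMaxAt-above r h p r<h with dyckFrom h p
... | true  = weakLRMaxAt-peaks-above r h p r<h
... | false = refl

countWeakMaxAt-down : ∀ r h p → suc h ≤ r →
  countWeakMaxAt r (suc h) (false ∷ p) ≡ δ (suc h) r * countDyck h p + countWeakMaxAt r h p
countWeakMaxAt-down r h p h<r with dyckFrom h p
... | true  = cong₂ _+_ (sym (ℕ.*-identityʳ (δ (suc h) r)))
    (trans (weakLRMaxAt-below r (suc h) (peaks h false p) h<r)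
           (sym (weakLRMaxAt-afterUp r h p h<r)))
... | false = sym (cong (_+ 0) (ℕ.*-zeroʳ (δ (suc h) r)))

weakMaxTotal : List Bool → ℕ
weakMaxTotal p = if isDyck p then weakLRMax p else 0

weakMaxTotal-decompose : ∀ N p → length p ≤ N → weakMaxTotal p ≡ sumTo N (λ r → countWeakMaxAt r 0 p)
weakMaxTotal-decompose N p p≤N with dyckFrom 0 p in dyck
... | false = sym (sumTo-zero N (λ _ _ → refl))
... | true  = begin
  weakLRMaxFrom 0 (peakHeightsFrom 0 p)             ≡⟨ cong (weakLRMaxFrom 0) (peakHeightsFrom≡peaks 0 p) ⟩
  weakLRMaxFrom 0 (peaks 0 false p)                 ≡⟨ weakLRMaxFrom-decompose N 0 (peaks 0 false p)
                                                         (All.map (InRange-mono p≤N) (peaks-inRange 0 false p λ ())) ⟩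
  sumTo N (λ r → weakLRMaxAt r 0 (peaks 0 false p)) ≡⟨ cong (λ ps → sumTo N (λ r → weakLRMaxAt r 0 ps))
                                                              (sym (peaks-ground p dyck)) ⟩
  sumTo N (λ r → weakLRMaxAt r 0 (peaks 0 true p))  ∎
  where
  open ≡-Reasoning
  peaks-ground : ∀ p → dyckFrom 0 p ≡ true → peaks 0 true p ≡ peaks 0 false p
  peaks-ground []          _  = refl
  peaks-ground (true ∷ p)  _  = refl
  peaks-ground (false ∷ p) ()

sumPaths-weakMaxTotal : ∀ N n → n ≤ N →
  sumPaths n weakMaxTotal ≡ sumTo N (λ r → sumPaths n (countWeakMaxAt r 0))
sumPaths-weakMaxTotal N n n≤N = trans
  (sumPaths-cong n (λ p ∣p∣≡n → weakMaxTotal-decompose N p (subst (_≤ N) (sym ∣p∣≡n) n≤N)))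
  (sym (sumTo-sumPaths N n (λ r → countWeakMaxAt r 0)))

dyckFrom-up : ∀ h p → dyckFrom h (true ∷ p) ≡ dyckFrom (suc h) p
dyckFrom-up zero    p = refl
dyckFrom-up (suc h) p = refl

dyckFrom-even : ∀ h p → dyckFrom h p ≡ true → (h + length p) % 2 ≡ 0
dyckFrom-even zero    []          _    = refl
dyckFrom-even h       (true ∷ p)  dyck =
  trans (cong (_% 2) (ℕ.+-suc h (length p))) (dyckFrom-even (suc h) p (trans (sym (dyckFrom-up h p)) dyck))
dyckFrom-even (suc h) (false ∷ p) dyck =
  trans (cong (λ n → suc n % 2) (ℕ.+-suc h (length p))) (dyckFrom-even h p dyck)

WTot≡sumPaths : ∀ n → WTot n ≡ + sumPaths n weakMaxTotal
WTot≡sumPaths zero          = refl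
WTot≡sumPaths (suc zero)    = refl
WTot≡sumPaths (suc (suc m)) with m % 2 in m%2
... | zero  = cong (λ k → + sumPaths k weakMaxTotal)
                   (cong (suc ∘ suc) (sym (trans (m≡m%n+[m/n]*n m 2) (cong (_+ m / 2 * 2) m%2))))
... | suc _ = cong +_ (sym (sumPaths-zero (suc (suc m)) odd-length))
  where
  odd-length : ∀ p → length p ≡ suc (suc m) → weakMaxTotal p ≡ 0
  odd-length p ∣p∣≡m+2 with dyckFrom 0 p in dyck
  ... | false = refl
  ... | true  with () ← trans (sym m%2) (trans (cong (_% 2) (sym ∣p∣≡m+2)) (dyckFrom-even 0 p dyck))

-- Generating functions of the counts

pathGF : (List Bool → ℕ) → Series
pathGF f n = + sumPaths n f

pathGF-cong : ∀ {f g} → (∀ p → f p ≡ g p) → pathGF f ≈ pathGF g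
pathGF-cong f≡g n = cong +_ (sumPaths-cong n (λ p _ → f≡g p))

pathGF-zero : ∀ {f} → (∀ p → f p ≡ 0) → pathGF f ≈ 𝟘
pathGF-zero f≡0 n = cong +_ (sumPaths-zero n (λ p _ → f≡0 p))

pathGF-+ : ∀ f g → pathGF (λ p → f p + g p) ≈ pathGF f ⊕ pathGF g
pathGF-+ f g n = cong +_ (sumPaths-+ n f g)

pathGF-step : ∀ f → f [] ≡ 0 → pathGF f ≈ Z ⊛ (pathGF (f ∘ (true ∷_)) ⊕ pathGF (f ∘ (false ∷_)))
pathGF-step f f[]≡0 = ≈Z⊛-shift (cong (λ x → + (x + 0)) f[]≡0) (λ n → cong +_ (sumPaths-suc n f))

dyckGF : ℕ → Series
dyckGF h = pathGF (countDyck h)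

dyckGF-ground : dyckGF 0 ≈ 𝟙 ⊕ Z ⊛ dyckGF 1
dyckGF-ground zero    = cong (ℤ._+_ (+ 1)) (sym (Z⊛-zero (dyckGF 1)))
dyckGF-ground (suc n) = begin
  dyckGF 0 (suc n)                    ≡⟨ cong +_ (trans (sumPaths-suc n (countDyck 0))
                                            (cong (_+_ (sumPaths n (countDyck 1))) (sumPaths-zero n (λ _ _ → refl)))) ⟩
  dyckGF 1 n ℤ.+ + 0                  ≡⟨ ℤ.+-identityʳ (dyckGF 1 n) ⟩
  dyckGF 1 n                          ≡⟨ sym (Z⊛-suc (dyckGF 1) n) ⟩
  (Z ⊛ dyckGF 1) (suc n)              ≡⟨ sym (ℤ.+-identityˡ _) ⟩
  (𝟙 ⊕ Z ⊛ dyckGF 1) (suc n)          ∎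
  where open ≡-Reasoning

dyckGF-solves : DyckSystem dyckGF
dyckGF-solves = record { ground = dyckGF-ground ; lifted = λ h → pathGF-step (countDyck (suc h)) refl }

weakMaxGF : ℕ → ℕ → Series
weakMaxGF r h = pathGF (countWeakMaxAt r h)

partialSum-sumTo : ∀ (t : ℕ → Series) (f : ℕ → ℕ) n → (∀ r → t (suc r) n ≡ + f (suc r)) →
                   ∀ N → partialSum (t ∘ suc) N n ≡ + sumTo N f
partialSum-sumTo t f n t≡f zero    = refl
partialSum-sumTo t f n t≡f (suc N) = cong₂ ℤ._+_ (partialSum-sumTo t f n t≡f N) (t≡f N)

-- A down step from height r completes a peak at height r, a weak left-to-right maximum for every
-- Dyck continuation from height r − 1; this is the source at the top of the segment system.
weakMaxGF-solves : ∀ r′ → SegmentSystem (suc r′) (dyckGF r′) (weakMaxGF (suc r′))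
weakMaxGF-solves r′ = record { inner = inner ; top = top }
  where
  open ≈-Reasoning
  r = suc r′
  step : ∀ h → weakMaxGF r h ≈ Z ⊛ (weakMaxGF r (suc h) ⊕ pathGF (countWeakMaxAt r h ∘ (false ∷_)))
  step h = ≈-trans (pathGF-step (countWeakMaxAt r h) (countWeakMaxAt-[] r h))
    (⊛-cong (≈-refl {Z}) (⊕-cong (pathGF-cong (countWeakMaxAt-up r h))
                                 (≈-refl {pathGF (countWeakMaxAt r h ∘ (false ∷_))})))
  down-inner : ∀ h p → suc h < r → countWeakMaxAt r (suc h) (false ∷ p) ≡ countWeakMaxAt r h p
  down-inner h p h+1<r = trans (countWeakMaxAt-down r h p (ℕ.<⇒≤ h+1<r))
    (cong (λ d → d * countDyck h p + countWeakMaxAt r h p) (δ-≢ (λ h+1≡r → ℕ.<-irrefl h+1≡r h+1<r)))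
  down-top : ∀ p → countWeakMaxAt r r (false ∷ p) ≡ countDyck r′ p + countWeakMaxAt r r′ p
  down-top p = trans (countWeakMaxAt-down r r′ p ℕ.≤-refl)
    (trans (cong (λ d → d * countDyck r′ p + countWeakMaxAt r r′ p) (δ-refl r))
           (cong (_+ countWeakMaxAt r r′ p) (ℕ.*-identityˡ (countDyck r′ p))))
  inner : ∀ h → h < r → weakMaxGF r h ≈ Z ⊛ (weakMaxGF r (suc h) ⊕ below (weakMaxGF r) h)
  inner zero    _     = ≈-trans (step 0)
    (Z⊛⊕-congʳ (weakMaxGF r 1) (pathGF-zero (λ _ → refl)))
  inner (suc h) h+1<r = ≈-trans (step (suc h))
    (Z⊛⊕-congʳ (weakMaxGF r (suc (suc h))) (pathGF-cong (λ p → down-inner h p h+1<r)))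
  top : weakMaxGF r r ≈ Z ⊛ (dyckGF r′ ⊕ below (weakMaxGF r) r)
  top = begin
    weakMaxGF r r
      ≈⟨ step r ⟩
    Z ⊛ (weakMaxGF r (suc r) ⊕ pathGF (countWeakMaxAt r r ∘ (false ∷_)))
      ≈⟨ ⊛-cong (≈-refl {Z}) (⊕-cong (pathGF-zero (λ p → countWeakMaxAt-above r (suc r) p ℕ.≤-refl))
                                     (pathGF-cong down-top)) ⟩
    Z ⊛ (𝟘 ⊕ pathGF (λ p → countDyck r′ p + countWeakMaxAt r r′ p))
      ≈⟨ ⊛-cong (≈-refl {Z}) (≈-trans (⊕-identityˡ _) (pathGF-+ (countDyck r′) (countWeakMaxAt r r′))) ⟩
    Z ⊛ (dyckGF r′ ⊕ weakMaxGF r r′)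
      ∎

-- The Catalan series

-- Squaring s = 1 − 2z²(1 + u) and comparing with s² = 1 − 4z² leaves 4z² (z²(1 + u)² − u) = 0.
catalan-relation : (s u : Series) → s ⊛ s ≈ 𝟙 ⊖ const (+ 4) ⊛ Z ^ₛ 2
  → const (+ 2) ⊛ Z ^ₛ 2 ⊛ u ≈ 𝟙 ⊖ const (+ 2) ⊛ Z ^ₛ 2 ⊖ s
  → u ≈ Z ⊛ Z ⊛ (𝟙 ⊕ u) ⊛ (𝟙 ⊕ u)
catalan-relation s u s²≈1-4z² 2z²u≈1-2z²-s n = sym (ℤ.i-j≡0⇒i≡j _ _ (d≈0 n))
  where
  open ≈-Reasoning
  a = 𝟙 ⊖ const (+ 2) ⊛ Z ^ₛ 2
  b = 𝟙 ⊖ const (+ 4) ⊛ Z ^ₛ 2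
  d = Z ⊛ Z ⊛ (𝟙 ⊕ u) ⊛ (𝟙 ⊕ u) ⊖ u
  s′ = a ⊖ const (+ 2) ⊛ Z ^ₛ 2 ⊛ u
  s≈s′ : s ≈ s′
  s≈s′ = begin
    s           ≈⟨ solve 2 (λ s a → s := a :- (a :- s)) ≈-refl s a ⟩
    a ⊖ (a ⊖ s) ≈⟨ ⊕-cong (≈-refl {a}) (λ n → cong -_ (sym (2z²u≈1-2z²-s n))) ⟩
    s′          ∎
  4z²d≈0 : const (+ 4) ⊛ (Z ⊛ (Z ⊛ d)) ≈ 𝟘
  4z²d≈0 = begin
    const (+ 4) ⊛ (Z ⊛ (Z ⊛ d))
      ≈⟨ solve 2 (λ z u → let z² = z :* (z :* 1ₚ); s′ = 1ₚ :- con (+ 2) :* z² :- con (+ 2) :* z² :* u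
                          in  con (+ 4) :* (z :* (z :* (z :* z :* (1ₚ :+ u) :* (1ₚ :+ u) :- u)))
                              := s′ :* s′ :- (1ₚ :- con (+ 4) :* z²)) ≈-refl Z u ⟩
    s′ ⊛ s′ ⊖ b ≈⟨ ⊕-cong (⊛-cong (≈-sym s≈s′) (≈-sym s≈s′)) (≈-refl { -ₛ b}) ⟩
    s ⊛ s ⊖ b   ≈⟨ (λ n → trans (cong (ℤ._- b n) (s²≈1-4z² n)) (ℤ.+-inverseʳ (b n))) ⟩
    𝟘           ∎
  d≈0 : d ≈ 𝟘
  d≈0 = Z⊛-cancel (≈-trans (Z⊛-cancel (≈-trans (const⊛-cancel (+ 4) 4z²d≈0) (≈-sym Z⊛𝟘))) (≈-sym Z⊛𝟘))
    where
    Z⊛𝟘 : Z ⊛ 𝟘 ≈ 𝟘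
    Z⊛𝟘 = ≈-trans (⊛-comm Z 𝟘) (⊛-zeroˡ Z)

module CatalanSeries (u : Series) (u≈z²C² : u ≈ Z ⊛ Z ⊛ (𝟙 ⊕ u) ⊛ (𝟙 ⊕ u)) where

  C : Series
  C = 𝟙 ⊕ u

  dyckForm : ℕ → Series
  dyckForm h = Z ^ₛ h ⊛ C ^ₛ suc h

  dyckForm-suc : ∀ h → dyckForm (suc h) ≈ Z ⊛ C ⊛ dyckForm h
  dyckForm-suc h = solve 4 (λ z c p q → z :* p :* (c :* q) := z :* c :* (p :* q)) ≈-refl
    Z C (Z ^ₛ h) (C ^ₛ suc h)

  dyckForm-+2 : ∀ h → dyckForm (suc (suc h)) ≈ u ⊛ dyckForm h
  dyckForm-+2 h = begin
    dyckForm (suc (suc h))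
      ≈⟨ solve 4 (λ z c p q → z :* (z :* p) :* (c :* (c :* q)) := z :* z :* c :* c :* (p :* q))
           ≈-refl Z C (Z ^ₛ h) (C ^ₛ suc h) ⟩
    Z ⊛ Z ⊛ C ⊛ C ⊛ dyckForm h
      ≈⟨ ⊛-cong (≈-sym u≈z²C²) (≈-refl {dyckForm h}) ⟩
    u ⊛ dyckForm h
      ∎
    where open ≈-Reasoning

  dyckForm-solves : DyckSystem dyckForm
  dyckForm-solves = record { ground = ground ; lifted = lifted }
    where
    open ≈-Reasoning
    ground : dyckForm 0 ≈ 𝟙 ⊕ Z ⊛ dyckForm 1
    ground = begin
      dyckForm 0
        ≈⟨ solve 1 (λ u → 1ₚ :* ((1ₚ :+ u) :* 1ₚ) := 1ₚ :+ u) ≈-refl u ⟩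
      𝟙 ⊕ u
        ≈⟨ ⊕-cong (≈-refl {𝟙}) u≈z²C² ⟩
      𝟙 ⊕ Z ⊛ Z ⊛ C ⊛ C
        ≈⟨ solve 2 (λ z c → 1ₚ :+ z :* z :* c :* c := 1ₚ :+ z :* (z :* 1ₚ :* (c :* (c :* 1ₚ)))) ≈-refl Z C ⟩
      𝟙 ⊕ Z ⊛ dyckForm 1
        ∎
    lifted : ∀ h → dyckForm (suc h) ≈ Z ⊛ (dyckForm (suc (suc h)) ⊕ dyckForm h)
    lifted h = begin
      dyckForm (suc h)
        ≈⟨ dyckForm-suc h ⟩
      Z ⊛ C ⊛ dyckForm h
        ≈⟨ solve 3 (λ z u d → z :* (1ₚ :+ u) :* d := z :* (u :* d :+ d)) ≈-refl Z u (dyckForm h) ⟩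
      Z ⊛ (u ⊛ dyckForm h ⊕ dyckForm h)
        ≈⟨ ⊛-cong (≈-refl {Z}) (⊕-cong (≈-sym (dyckForm-+2 h)) (≈-refl {dyckForm h})) ⟩
      Z ⊛ (dyckForm (suc (suc h)) ⊕ dyckForm h)
        ∎

  walkForm : ℕ → ℕ → Series
  walkForm m h = dyckForm m ⊛ (𝟙 ⊖ u ^ₛ suc h)

  walkForm-ground : ∀ m → walkForm (suc m) 0 ≈ Z ⊛ walkForm m 1
  walkForm-ground m = begin
    walkForm (suc m) 0
      ≈⟨ ⊛-cong (dyckForm-suc m) (≈-refl {𝟙 ⊖ u ^ₛ 1}) ⟩
    Z ⊛ C ⊛ dyckForm m ⊛ (𝟙 ⊖ u ^ₛ 1)
      ≈⟨ solve 3 (λ z u d → z :* (1ₚ :+ u) :* d :* (1ₚ :- u :* 1ₚ) := z :* (d :* (1ₚ :- u :* (u :* 1ₚ))))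
           ≈-refl Z u (dyckForm m) ⟩
    Z ⊛ walkForm m 1
      ∎
    where open ≈-Reasoning

  walkForm-lifted : ∀ m h →
    walkForm (suc m) (suc h) ≈ Z ⊛ (walkForm m (suc (suc h)) ⊕ walkForm (suc (suc m)) h)
  walkForm-lifted m h = begin
    walkForm (suc m) (suc h)
      ≈⟨ ⊛-cong (dyckForm-suc m) (≈-refl {𝟙 ⊖ u ^ₛ suc (suc h)}) ⟩
    Z ⊛ C ⊛ dyckForm m ⊛ (𝟙 ⊖ u ⊛ v)
      ≈⟨ solve 4 (λ z u d v → z :* (1ₚ :+ u) :* d :* (1ₚ :- u :* v)
                            := z :* (d :* (1ₚ :- u :* (u :* v)) :+ u :* d :* (1ₚ :- v)))
           ≈-refl Z u (dyckForm m) v ⟩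
    Z ⊛ (walkForm m (suc (suc h)) ⊕ u ⊛ dyckForm m ⊛ (𝟙 ⊖ v))
      ≈⟨ Z⊛⊕-congʳ (walkForm m (suc (suc h))) (⊛-cong (≈-sym (dyckForm-+2 m)) (≈-refl {𝟙 ⊖ v})) ⟩
    Z ⊛ (walkForm m (suc (suc h)) ⊕ walkForm (suc (suc m)) h)
      ∎
    where
    open ≈-Reasoning
    v = u ^ₛ suc h

  dyckForm-double : ∀ m → dyckForm (m + m) ≈ u ^ₛ m ⊛ dyckForm 0
  dyckForm-double zero    = ≈-sym (⊛-identityˡ (dyckForm 0))
  dyckForm-double (suc m) = begin
    dyckForm (suc m + suc m)           ≈⟨ ≡⇒≈ (cong (dyckForm ∘ suc) (ℕ.+-suc m m)) ⟩
    dyckForm (suc (suc (m + m)))       ≈⟨ dyckForm-+2 (m + m) ⟩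
    u ⊛ dyckForm (m + m)               ≈⟨ ⊛-cong (≈-refl {u}) (dyckForm-double m) ⟩
    u ⊛ (u ^ₛ m ⊛ dyckForm 0)          ≈⟨ ≈-sym (⊛-assoc u (u ^ₛ m) (dyckForm 0)) ⟩
    u ^ₛ suc m ⊛ dyckForm 0            ∎
    where open ≈-Reasoning

  walkForm-diagonal : ∀ m → walkForm (m + m) 0 ≈ (𝟙 ⊖ u ^ₛ 2) ⊛ u ^ₛ m
  walkForm-diagonal m = begin
    walkForm (m + m) 0
      ≈⟨ ⊛-cong (dyckForm-double m) (≈-refl {𝟙 ⊖ u ^ₛ 1}) ⟩
    u ^ₛ m ⊛ dyckForm 0 ⊛ (𝟙 ⊖ u ^ₛ 1)
      ≈⟨ solve 2 (λ p u → p :* (1ₚ :* ((1ₚ :+ u) :* 1ₚ)) :* (1ₚ :- u :* 1ₚ) := (1ₚ :- u :* (u :* 1ₚ)) :* p)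
           ≈-refl (u ^ₛ m) u ⟩
    (𝟙 ⊖ u ^ₛ 2) ⊛ u ^ₛ m
      ∎
    where open ≈-Reasoning

  -- z^(2r−h) C^(2r−h+1) (1 − u^(h+1)): the solution of the segment system of height r, times 1 − u^(r+2)
  walkSolution : ℕ → ℕ → Series
  walkSolution r h = walkForm (r + (r ∸ h)) h

  exponent-suc : ∀ {r h} → h < r → r + (r ∸ h) ≡ suc (r + (r ∸ suc h))
  exponent-suc {r} h<r = trans (cong (_+_ r) (ℕ.+-∸-assoc 1 h<r)) (ℕ.+-suc r _)

  walkSolution-≈ : ∀ r h {m} → r + (r ∸ h) ≡ m → walkSolution r h ≈ walkForm m h
  walkSolution-≈ r h e = ≡⇒≈ (cong (λ m → walkForm m h) e)

  walkSolution-solves : ∀ r′ → SegmentSystem (suc r′) (walkForm r′ (suc (suc r′))) (walkSolution (suc r′))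
  walkSolution-solves r′ = record { inner = inner ; top = top }
    where
    open ≈-Reasoning
    r = suc r′
    inner : ∀ h → h < r → walkSolution r h ≈ Z ⊛ (walkSolution r (suc h) ⊕ below (walkSolution r) h)
    inner zero 0<r = begin
      walkSolution r 0                   ≈⟨ walkSolution-≈ r 0 (exponent-suc 0<r) ⟩
      walkForm (suc m) 0                 ≈⟨ walkForm-ground m ⟩
      Z ⊛ walkSolution r 1               ≈⟨ ⊛-cong (≈-refl {Z}) (≈-sym (⊕-identityʳ (walkSolution r 1))) ⟩
      Z ⊛ (walkSolution r 1 ⊕ 𝟘)         ∎
      where m = r + (r ∸ 1)
    inner (suc h) h+1<r = begin
      walkSolution r (suc h)                             ≈⟨ walkSolution-≈ r (suc h) (exponent-suc h+1<r) ⟩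
      walkForm (suc m) (suc h)                           ≈⟨ walkForm-lifted m h ⟩
      Z ⊛ (walkSolution r (suc (suc h)) ⊕ walkForm (suc (suc m)) h)
        ≈⟨ Z⊛⊕-congʳ (walkSolution r (suc (suc h)))
             (≈-sym (walkSolution-≈ r h (trans (exponent-suc (ℕ.<⇒≤ h+1<r)) (cong suc (exponent-suc h+1<r))))) ⟩
      Z ⊛ (walkSolution r (suc (suc h)) ⊕ walkSolution r h) ∎
      where m = r + (r ∸ suc (suc h))
    r+[r∸r]≡r : r + (r ∸ r) ≡ r
    r+[r∸r]≡r = trans (cong (_+_ r) (ℕ.n∸n≡0 r)) (ℕ.+-identityʳ r)
    top : walkSolution r r ≈ Z ⊛ (walkForm r′ (suc r) ⊕ below (walkSolution r) r)
    top = begin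
      walkSolution r r                                   ≈⟨ walkSolution-≈ r r r+[r∸r]≡r ⟩
      walkForm r r                                       ≈⟨ walkForm-lifted r′ r′ ⟩
      Z ⊛ (walkForm r′ (suc r) ⊕ walkForm (suc r) r′)
        ≈⟨ Z⊛⊕-congʳ (walkForm r′ (suc r))
             (≈-sym (walkSolution-≈ r r′ (trans (exponent-suc (ℕ.n<1+n r′)) (cong suc r+[r∸r]≡r)))) ⟩
      Z ⊛ (walkForm r′ (suc r) ⊕ walkSolution r r′)      ∎

  u₀≡0 : u 0 ≡ + 0
  u₀≡0 = trans (u≈z²C² 0) (trans (reassociate 0) (Z⊛-zero (Z ⊛ C ⊛ C)))
    where
    reassociate : Z ⊛ Z ⊛ C ⊛ C ≈ Z ⊛ (Z ⊛ C ⊛ C)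
    reassociate = solve 2 (λ z c → z :* z :* c :* c := z :* (z :* c :* c)) ≈-refl Z C

  1-u^[k+1]₀≡1 : ∀ k → (𝟙 ⊖ u ^ₛ suc k) 0 ≡ + 1
  1-u^[k+1]₀≡1 k = cong (ℤ._-_ (+ 1)) (trans (cong (ℤ._* (u ^ₛ k) 0) u₀≡0) (ℤ.*-zeroˡ ((u ^ₛ k) 0)))

  weakMaxGF-closedForm : ∀ r′ →
    weakMaxGF (suc r′) 0 ⊛ (𝟙 ⊖ u ^ₛ (2 + suc r′)) ≈ (𝟙 ⊖ u ^ₛ 2) ⊛ u ^ₛ suc r′
  weakMaxGF-closedForm r′ = ≈-trans
    (SegmentSystem-unique (SegmentSystem-⊛ (weakMaxGF-solves r′) c) (walkSolution-solves r′)
       (⊛-cong (DyckSystem-unique dyckGF-solves dyckForm-solves r′) (≈-refl {c})) 0 z≤n)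
    (walkForm-diagonal (suc r′))
    where c = 𝟙 ⊖ u ^ₛ (2 + suc r′)

theorem8 : (s u : Series) → s 0 ≡ + 1 → s ⊛ s ≈ 𝟙 ⊖ const (+ 4) ⊛ Z ^ₛ 2
    → const (+ 2) ⊛ Z ^ₛ 2 ⊛ u ≈ 𝟙 ⊖ const (+ 2) ⊛ Z ^ₛ 2 ⊖ s
    → (t : ℕ → Series)
    → (∀ r → t r ⊛ (𝟙 ⊖ u ^ₛ (2 + r)) ≈ (𝟙 ⊖ u ^ₛ 2) ⊛ u ^ₛ r)
    → SumsTo (λ r → t (suc r)) WTot
theorem8 s u _ s² 2z²u t t⊛unit n = n , λ N n≤N → begin
  partialSum (t ∘ suc) N n                              ≡⟨ partialSum-sumTo t _ n (λ r → t≈weakMaxGF r n) N ⟩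
  + sumTo N (λ r → sumPaths n (countWeakMaxAt r 0))     ≡⟨ cong +_ (sym (sumPaths-weakMaxTotal N n n≤N)) ⟩
  + sumPaths n weakMaxTotal                             ≡⟨ sym (WTot≡sumPaths n) ⟩
  WTot n                                                ∎
  where
  open ≡-Reasoning
  open CatalanSeries u (catalan-relation s u s² 2z²u)
  t≈weakMaxGF : ∀ r′ → t (suc r′) ≈ weakMaxGF (suc r′) 0
  t≈weakMaxGF r′ = ⊛-cancel-unit {c = 𝟙 ⊖ u ^ₛ (2 + suc r′)} (1-u^[k+1]₀≡1 (suc (suc r′)))
    (≈-trans (t⊛unit (suc r′)) (≈-sym (weakMaxGF-closedForm r′)))
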